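{- Let $\mathcal C$ be an identity type category. Suppose $i\colon A\to B$ and $j\colon A\to C$ are $\mathcal I$-maps and $p\colon B\to A$ and $q\colon C\to A$ are $\mathcal P$-maps with $p\circ i=\mathrm{id}_A=q\circ j$. Then the induced map $(i,j)\colon A\to B\times_AC$ (into the pullback of $p$ and $q$) is an $\mathcal I$-map.
   Context: Identity type category: a category $\mathcal C$ with classes $\mathcal I,\mathcal P$ of maps such that: (Empty) $\mathcal C$ has a terminal object $1$ and each $A\to1$ is in $\mathcal P$; (Composition) both classes contain identities and are closed under composition; (Stability) pullbacks of $\mathcal P$-maps along arbitrary maps exist and are $\mathcal P$-maps; (Frobenius) the pullback of an $\mathcal I$-map along a $\mathcal P$-map is an $\mathcal I$-map; (Orthogonality) for every commutative square $g\circ i=p\circ f$ with $i\colon A\to B$ in $\mathcal I$, $p\colon C\to D$ in $\mathcal P$, $f\colon A\to C$, $g\colon B\to D$, there is $j\colon B\to C$ with $ji=f$, $pj=g$; (Identities) for every $\mathcal P$-map $p\colon C\to D$ the diagonal $C\to C\times_DC$ factors as $e\circ r$ with $r\in\mathcal I$, $e\in\mathcal P$. -}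

module Defs where

open import Level using (Level; _⊔_) renaming (suc to lsuc)
open import Data.Product using (Σ; _×_; _,_; proj₁; proj₂)
open import Relation.Binary.PropositionalEquality using (_≡_; refl)

record Category (o ℓ : Level) : Set (lsuc (o ⊔ ℓ)) where
  infixr 9 _∘_
  field
    Obj : Set o
    _⇒_ : Obj → Obj → Set ℓ
    id  : ∀ {A} → A ⇒ A
    _∘_ : ∀ {A B C} → B ⇒ C → A ⇒ B → A ⇒ C
    identityˡ : ∀ {A B} {f : A ⇒ B} → id ∘ f ≡ f
    identityʳ : ∀ {A B} {f : A ⇒ B} → f ∘ id ≡ f
    assoc : ∀ {A B C D} {f : A ⇒ B} {g : B ⇒ C} {h : C ⇒ D} →
            (h ∘ g) ∘ f ≡ h ∘ (g ∘ f)

module _ {o ℓ} (𝒞 : Category o ℓ) where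
  open Category 𝒞

  IsTerminal : Obj → Set (o ⊔ ℓ)
  IsTerminal T = ∀ X → Σ (X ⇒ T) λ t → ∀ (t' : X ⇒ T) → t' ≡ t

  record IsPullback {X Y Z P : Obj} (f : X ⇒ Z) (g : Y ⇒ Z)
                    (π₁ : P ⇒ X) (π₂ : P ⇒ Y) : Set (o ⊔ ℓ) where
    field
      commute : f ∘ π₁ ≡ g ∘ π₂
      universal : ∀ {W} (a : W ⇒ X) (b : W ⇒ Y) → f ∘ a ≡ g ∘ b →
        Σ (W ⇒ P) λ u → (π₁ ∘ u ≡ a) × (π₂ ∘ u ≡ b) ×
          (∀ (v : W ⇒ P) → π₁ ∘ v ≡ a → π₂ ∘ v ≡ b → v ≡ u)

  pairing : ∀ {X Y Z P W : Obj} {f : X ⇒ Z} {g : Y ⇒ Z} {π₁ : P ⇒ X} {π₂ : P ⇒ Y} →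
            IsPullback f g π₁ π₂ → (a : W ⇒ X) (b : W ⇒ Y) → f ∘ a ≡ g ∘ b → W ⇒ P
  pairing pb a b e = proj₁ (IsPullback.universal pb a b e)

  diagonal : ∀ {C D Q : Obj} {p : C ⇒ D} {π₁ π₂ : Q ⇒ C} →
             IsPullback p p π₁ π₂ → C ⇒ Q
  diagonal pb = pairing pb id id refl

  record IdentityTypeCategory (r : Level) : Set (o ⊔ ℓ ⊔ lsuc r) where
    field
      I : ∀ {A B} → A ⇒ B → Set r
      P : ∀ {A B} → A ⇒ B → Set r
      terminal : Σ Obj λ T → IsTerminal T × (∀ A (t : A ⇒ T) → P t)
      I-id : ∀ {A} → I (id {A})
      P-id : ∀ {A} → P (id {A})
      I-∘ : ∀ {A B C} {f : A ⇒ B} {g : B ⇒ C} → I f → I g → I (g ∘ f)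
      P-∘ : ∀ {A B C} {f : A ⇒ B} {g : B ⇒ C} → P f → P g → P (g ∘ f)
      P-pullback-exists : ∀ {C D E} (p : C ⇒ D) → P p → (f : E ⇒ D) →
        Σ Obj λ Q → Σ (Q ⇒ E) λ p' → Σ (Q ⇒ C) λ f' → IsPullback f p p' f'
      P-pullback-stable : ∀ {C D E Q} {p : C ⇒ D} {f : E ⇒ D}
        {p' : Q ⇒ E} {f' : Q ⇒ C} → P p → IsPullback f p p' f' → P p'
      frobenius : ∀ {A C D Q} {i : A ⇒ D} {p : C ⇒ D}
        {i' : Q ⇒ C} {p' : Q ⇒ A} → I i → P p → IsPullback p i i' p' → I i'
      orthogonality : ∀ {A B C D} {i : A ⇒ B} {p : C ⇒ D} (f : A ⇒ C) (g : B ⇒ D) →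
        I i → P p → g ∘ i ≡ p ∘ f →
        Σ (B ⇒ C) λ j → (j ∘ i ≡ f) × (p ∘ j ≡ g)
      identities : ∀ {C D Q} {p : C ⇒ D} {π₁ π₂ : Q ⇒ C} → P p →
        (pb : IsPullback p p π₁ π₂) →
        Σ Obj λ M → Σ (C ⇒ M) λ r → Σ (M ⇒ Q) λ e →
          I r × P e × (e ∘ r ≡ diagonal pb)

module Submission where

-- Write Q = B ×_A C with projections π₁, π₂ and let k = (i∘q, id) : C → Q.
-- Because i is a section of p, the square  π₁ ∘ k = i ∘ q  is itself a pullback:
-- it exhibits C as the pullback of the I-map i along the P-map π₁ (π₁ is a P-map,
-- being the pullback of q).  By (Frobenius) k is an I-map, and since q ∘ j = id the
-- induced map (i , j) equals k ∘ j, a composite of I-maps.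

open import Defs
open import Level using (Level)
open import Relation.Binary.PropositionalEquality
  using (_≡_; refl; sym; trans; cong; subst; module ≡-Reasoning)
open import Data.Product using (Σ; _×_; _,_; proj₁; proj₂)

module PullbackFacts {o ℓ : Level} (𝒞 : Category o ℓ) where
  open Category 𝒞
  open ≡-Reasoning

  pullˡ : ∀ {W X Y Z} {x : W ⇒ X} {f : X ⇒ Y} {g : Y ⇒ Z} {h : X ⇒ Z} →
          g ∘ f ≡ h → g ∘ (f ∘ x) ≡ h ∘ x
  pullˡ {x = x} e = trans (sym assoc) (cong (_∘ x) e)

  module _ {X Y Z Pb : Obj} {f : X ⇒ Z} {g : Y ⇒ Z} {π₁ : Pb ⇒ X} {π₂ : Pb ⇒ Y}
           (pb : IsPullback 𝒞 f g π₁ π₂) where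
    open IsPullback pb

    pairing-unique : ∀ {W} {a : W ⇒ X} {b : W ⇒ Y} (e : f ∘ a ≡ g ∘ b) (v : W ⇒ Pb) →
                     π₁ ∘ v ≡ a → π₂ ∘ v ≡ b → v ≡ pairing 𝒞 pb a b e
    pairing-unique {a = a} {b} e v e₁ e₂ = proj₂ (proj₂ (proj₂ (universal a b e))) v e₁ e₂

    pullback-ext : ∀ {W} (v w : W ⇒ Pb) → π₁ ∘ v ≡ π₁ ∘ w → π₂ ∘ v ≡ π₂ ∘ w → v ≡ w
    pullback-ext v w e₁ e₂ =
      trans (pairing-unique commute-w v e₁ e₂) (sym (pairing-unique commute-w w refl refl))
      where
      commute-w : f ∘ (π₁ ∘ w) ≡ g ∘ (π₂ ∘ w)
      commute-w = trans (pullˡ commute) assoc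

  module SectionLift {A B C Q : Obj} {p : B ⇒ A} {q : C ⇒ A} {π₁ : Q ⇒ B} {π₂ : Q ⇒ C}
                     (pb : IsPullback 𝒞 p q π₁ π₂) (i : A ⇒ B) (pi≡id : p ∘ i ≡ id) where
    open IsPullback pb

    lift-commutes : p ∘ (i ∘ q) ≡ q ∘ id
    lift-commutes = trans (pullˡ pi≡id) (trans identityˡ (sym identityʳ))

    k : C ⇒ Q
    k = pairing 𝒞 pb (i ∘ q) id lift-commutes

    π₁∘k : π₁ ∘ k ≡ i ∘ q
    π₁∘k = proj₁ (proj₂ (universal (i ∘ q) id lift-commutes))

    π₂∘k : π₂ ∘ k ≡ id
    π₂∘k = proj₁ (proj₂ (proj₂ (universal (i ∘ q) id lift-commutes)))

    -- The square  π₁ ∘ k = i ∘ q  is a pullback: a map a : W → Q lying over i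
    -- factors uniquely through k, namely via π₂ ∘ a.
    lift-pullback : IsPullback 𝒞 π₁ i k q
    lift-pullback = record { commute = π₁∘k ; universal = factor }
      where
      factor : ∀ {W} (a : W ⇒ Q) (b : W ⇒ A) → π₁ ∘ a ≡ i ∘ b →
        Σ (W ⇒ C) λ u → (k ∘ u ≡ a) × (q ∘ u ≡ b) ×
          (∀ (v : W ⇒ C) → k ∘ v ≡ a → q ∘ v ≡ b → v ≡ u)
      factor {W} a b e = π₂ ∘ a , k∘π₂a , q∘π₂a , unique
        where
        q∘π₂a : q ∘ (π₂ ∘ a) ≡ b
        q∘π₂a = begin
          q ∘ (π₂ ∘ a) ≡⟨ pullˡ (sym commute) ⟩
          (p ∘ π₁) ∘ a ≡⟨ assoc ⟩
          p ∘ (π₁ ∘ a) ≡⟨ cong (p ∘_) e ⟩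
          p ∘ (i ∘ b)  ≡⟨ pullˡ pi≡id ⟩
          id ∘ b       ≡⟨ identityˡ ⟩
          b            ∎

        k∘π₂a : k ∘ (π₂ ∘ a) ≡ a
        k∘π₂a = pullback-ext pb _ _
          (begin
            π₁ ∘ (k ∘ (π₂ ∘ a)) ≡⟨ pullˡ π₁∘k ⟩
            (i ∘ q) ∘ (π₂ ∘ a)  ≡⟨ assoc ⟩
            i ∘ (q ∘ (π₂ ∘ a))  ≡⟨ cong (i ∘_) q∘π₂a ⟩
            i ∘ b               ≡⟨ sym e ⟩
            π₁ ∘ a              ∎)
          (trans (pullˡ π₂∘k) identityˡ)

        unique : ∀ (v : W ⇒ C) → k ∘ v ≡ a → q ∘ v ≡ b → v ≡ π₂ ∘ a
        unique v kv≡a _ = begin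
          v            ≡⟨ sym identityˡ ⟩
          id ∘ v       ≡⟨ cong (_∘ v) (sym π₂∘k) ⟩
          (π₂ ∘ k) ∘ v ≡⟨ assoc ⟩
          π₂ ∘ (k ∘ v) ≡⟨ cong (π₂ ∘_) kv≡a ⟩
          π₂ ∘ a       ∎

    pairing-via-lift : ∀ (j : A ⇒ C) → q ∘ j ≡ id → (e : p ∘ i ≡ q ∘ j) →
                       k ∘ j ≡ pairing 𝒞 pb i j e
    pairing-via-lift j qj≡id e = pairing-unique pb e (k ∘ j) π₁∘kj (trans (pullˡ π₂∘k) identityˡ)
      where
      π₁∘kj : π₁ ∘ (k ∘ j) ≡ i
      π₁∘kj = begin
        π₁ ∘ (k ∘ j)  ≡⟨ pullˡ π₁∘k ⟩
        (i ∘ q) ∘ j   ≡⟨ assoc ⟩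
        i ∘ (q ∘ j)   ≡⟨ cong (i ∘_) qj≡id ⟩
        i ∘ id        ≡⟨ identityʳ ⟩
        i             ∎

lemma3p4p6 : ∀ {o ℓ r : Level} (𝒞 : Category o ℓ) (T : IdentityTypeCategory 𝒞 r) →
    let open Category 𝒞
        open IdentityTypeCategory T
    in ∀ {A B C : Obj} (i : A ⇒ B) (j : A ⇒ C) (p : B ⇒ A) (q : C ⇒ A) →
       I i → I j → P p → P q →
       (pi≡id : p ∘ i ≡ id) → (qj≡id : q ∘ j ≡ id) →
       ∀ {Q : Obj} (π₁ : Q ⇒ B) (π₂ : Q ⇒ C) (pb : IsPullback 𝒞 p q π₁ π₂) →
       I (pairing 𝒞 pb i j (trans pi≡id (sym qj≡id)))
lemma3p4p6 𝒞 T i j p q Ii Ij _ Pq pi≡id qj≡id π₁ π₂ pb =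
  subst I (pairing-via-lift j qj≡id (trans pi≡id (sym qj≡id))) (I-∘ Ij Ik)
  where
  open IdentityTypeCategory T
  open PullbackFacts.SectionLift 𝒞 pb i pi≡id

  Ik : I k
  Ik = frobenius Ii (P-pullback-stable Pq pb) lift-pullback
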